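{- Let $\mathbf{N}\in\mathbb{N}_0^n$ and $I\subset\{1,\dots,n\}$. Then $\mathcal{J}(I,\mathbf{N})$ is a finite set and $\mathcal{J}(I,\mathbf{N})\subset\{0,1,\dots,|\mathbf{N}|+n\}^n$.
   Context: For $\mathbf{N},\boldsymbol{\alpha}\in\mathbb{N}_0^n$: $K(\mathbf{N},\boldsymbol{\alpha})=\{j\in\{1,\dots,n\}:(n+1-j)+\sum_{i=j}^nN_i=\sum_{i=j}^n\alpha_i\}$, $L(\mathbf{N},\boldsymbol{\alpha})=\{j\in\{1,\dots,n\}:\alpha_j\ge N_j+1\}$, and $\mathcal{J}(I,\mathbf{N})=\{\boldsymbol{\alpha}\in\mathbb{N}_0^n:K(\mathbf{N},\boldsymbol{\alpha})=I\text{ and }|L(\mathbf{N},\boldsymbol{\alpha})|=|I|\}$. $|\mathbf{N}|=N_1+\dots+N_n$. -}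

module Defs where

open import Data.Nat using (ℕ; zero; suc; _+_; _∸_; _≤_; _≟_; _≤?_)
open import Data.Fin using (Fin; toℕ; zero; suc)
open import Data.Fin.Subset using (Subset; ∣_∣)
open import Data.Vec using (Vec; []; _∷_; tabulate; lookup)
open import Data.Bool using (Bool)
open import Relation.Nullary.Decidable using (does)
open import Relation.Binary.PropositionalEquality using (_≡_)
open import Data.Product using (_×_)

-- Vectors in ℕ₀ⁿ are Vec ℕ n; index (j : Fin n) stands for j+1 ∈ {1,…,n}.
Vecℕ : ℕ → Set
Vecℕ n = Vec ℕ n

total : ∀ {n} → Vecℕ n → ℕ
total [] = 0
total (x ∷ v) = x + total v

tailSum : ∀ {n} → Vecℕ n → Fin n → ℕ
tailSum v zero = total v
tailSum (x ∷ v) (suc j) = tailSum v j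

-- K(N, α) = { j : (n+1-j) + Σ_{i≥j} N_i = Σ_{i≥j} α_i }   (for 0-based j: n+1-(j+1) = n - j)
K : ∀ {n} → Vecℕ n → Vecℕ n → Subset n
K {n} N α = tabulate λ j → does (((n ∸ toℕ j) + tailSum N j) ≟ tailSum α j)

L : ∀ {n} → Vecℕ n → Vecℕ n → Subset n
L N α = tabulate λ j → does (suc (lookup N j) ≤? lookup α j)

_∈𝒥[_,_] : ∀ {n} → Vecℕ n → Subset n → Vecℕ n → Set
α ∈𝒥[ I , N ] = (K N α ≡ I) × (∣ L N α ∣ ≡ ∣ I ∣)

module Submission where

-- Read a pair (N, α) from its last coordinate backwards as a
-- walk: position j contributes the step α_j - N_j - 1, j ∈ K(N,α) exactly when
-- the walk started at j ends at 0 (Σ_{i≥j} α_i = (n+1-j) + Σ_{i≥j} N_i), and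
-- j ∈ L(N,α) exactly when the step at j is non-negative.  Induction on n shows
--   |K| ≤ |L|,  and  |K| < |L|  whenever  n + |N| < |α|,
-- because every return to 0 is either a non-negative step or is preceded by a
-- surplus that was paid for by an earlier non-negative step.  For α ∈ 𝒥(I,N)
-- we have |K| = |I| = |L|, hence |α| ≤ n + |N|, which bounds every coordinate.
-- Finiteness then follows from a general fact: a decidable set of vectors
-- with bounded coordinates is the set of members of an explicit list (filter
-- the finite box {0,…,B}ⁿ).

open import Defs
open import Data.Nat using (ℕ; _+_; _≤_)
open import Data.Fin using (Fin)
open import Data.Vec using (lookup)
open import Data.Fin.Subset using (Subset)
open import Data.List using (List)
open import Data.List.Membership.Propositional using (_∈_)
open import Data.Product using (Σ; _×_)
open import Function.Bundles using (_⇔_)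

open import Data.Nat using (suc; zero; _<_; _≟_; _≤?_; s≤s; z≤n)
open import Data.Nat.Properties
  using (≤-trans; ≤-reflexive; <-irrefl; <⇒≤; ≮⇒≥; m≤n⇒m≤1+n; m≤m+n; m≤n+m;
         +-monoˡ-≤; +-cancelˡ-<; +-comm; ≤-refl; +-commutativeSemigroup; module ≤-Reasoning)
open import Algebra.Properties.CommutativeSemigroup +-commutativeSemigroup
  using (x∙yz≈y∙xz)
open import Data.Fin using (zero; suc)
open import Data.Fin.Subset using (∣_∣)
open import Data.Vec using (Vec; []; _∷_)
open import Data.Vec.Properties using (≡-dec)
import Data.Bool as Bool
open import Data.List using ([]; _∷_; filter; cartesianProductWith; upTo)
open import Data.List.Membership.Propositional.Properties
  using (∈-filter⁺; ∈-filter⁻; ∈-cartesianProductWith⁺; ∈-upTo⁺)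
open import Data.List.Relation.Unary.Any using (here)
open import Data.Product using (_,_; proj₁; proj₂)
open import Relation.Binary.PropositionalEquality using (_≡_; refl; trans; sym; cong)
open import Relation.Nullary using (Dec; does; yes; no; contradiction)
open import Relation.Nullary.Decidable using (_×-dec_)
open import Relation.Unary using (Decidable)
open import Function.Bundles using (mk⇔)

Balanced : ∀ {m} → ℕ → ℕ → ℕ → Subset m → Subset m → Set
Balanced n t s K′ L′ = (n + t < s → ∣ K′ ∣ < ∣ L′ ∣) × (∣ K′ ∣ ≤ ∣ L′ ∣)

-- A return to 0 through a negative step (a ≤ x) means the tail was in surplus.
return⇒surplus : ∀ n t s x a → a ≤ x → suc n + (x + t) ≤ a + s → n + t < s
return⇒surplus n t s x a a≤x ret = +-cancelˡ-< a (n + t) s (begin-strict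
  a + (n + t)   ≤⟨ +-monoˡ-≤ (n + t) a≤x ⟩
  x + (n + t)   ≡⟨ x∙yz≈y∙xz x n t ⟩
  n + (x + t)   <⟨ ≤-refl ⟩
  suc n + (x + t) ≤⟨ ret ⟩
  a + s         ∎)
  where open ≤-Reasoning

-- One step of the walk preserves balance: prepending a coordinate (x, a)
-- adds the head to K iff the walk returns to 0, and to L iff x < a.
balanced-step : ∀ {m n t s x a} {K′ L′ : Subset m}
  (k? : Dec (suc n + (x + t) ≡ a + s)) (l? : Dec (x < a)) →
  Balanced n t s K′ L′ →
  Balanced (suc n) (x + t) (a + s) (does k? ∷ K′) (does l? ∷ L′)
balanced-step (yes ret) (yes _) (_ , K≤L) =
  (λ surplus → contradiction ret (λ eq → <-irrefl eq surplus)) , s≤s K≤L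
balanced-step {n = n} {t} {s} {x} {a} (yes ret) (no x≮a) (K<L , _) =
  (λ surplus → contradiction ret (λ eq → <-irrefl eq surplus)) ,
  K<L (return⇒surplus n t s x a (≮⇒≥ x≮a) (≤-reflexive ret))
balanced-step (no _) (yes _) (_ , K≤L) = (λ _ → s≤s K≤L) , m≤n⇒m≤1+n K≤L
balanced-step {n = n} {t} {s} {x} {a} (no _) (no x≮a) (K<L , K≤L) =
  (λ surplus → K<L (return⇒surplus n t s x a (≮⇒≥ x≮a) (<⇒≤ surplus))) , K≤L

-- Every pair (N, α) is balanced; K and L unfold coordinate-wise definitionally.
balanced : ∀ n (N α : Vecℕ n) → Balanced n (total N) (total α) (K N α) (L N α)
balanced zero [] [] = (λ ()) , z≤n
balanced (suc n) (x ∷ N) (a ∷ α) =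
  balanced-step {n = n} {total N} {total α} {x} {a} {K N α} {L N α}
    (suc n + (x + total N) ≟ a + total α) (suc x ≤? a) (balanced n N α)

∈𝒥⇒total≤ : ∀ n (N : Vecℕ n) (I : Subset n) (α : Vecℕ n) →
  α ∈𝒥[ I , N ] → total α ≤ n + total N
∈𝒥⇒total≤ n N I α (K≡I , ∣L∣≡∣I∣) = ≮⇒≥ λ surplus →
  <-irrefl (trans (cong ∣_∣ K≡I) (sym ∣L∣≡∣I∣)) (proj₁ (balanced n N α) surplus)

lookup≤total : ∀ {n} (α : Vecℕ n) (j : Fin n) → lookup α j ≤ total α
lookup≤total (a ∷ α) zero = m≤m+n a (total α)
lookup≤total (a ∷ α) (suc j) = ≤-trans (lookup≤total α j) (m≤n+m (total α) a)

_∈𝒥?[_,_] : ∀ {n} (α : Vecℕ n) (I : Subset n) (N : Vecℕ n) → Dec (α ∈𝒥[ I , N ])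
α ∈𝒥?[ I , N ] = ≡-dec Bool._≟_ (K N α) I ×-dec (∣ L N α ∣ ≟ ∣ I ∣)

box : ℕ → (n : ℕ) → List (Vecℕ n)
box B zero = [] ∷ []
box B (suc n) = cartesianProductWith _∷_ (upTo (suc B)) (box B n)

∈-box : ∀ B n (α : Vecℕ n) → ((j : Fin n) → lookup α j ≤ B) → α ∈ box B n
∈-box B zero [] _ = here refl
∈-box B (suc n) (a ∷ α) bounded =
  ∈-cartesianProductWith⁺ _∷_ (∈-upTo⁺ (s≤s (bounded zero)))
    (∈-box B n α (λ j → bounded (suc j)))

bounded⇒listable : ∀ {n} {P : Vecℕ n → Set} (P? : Decidable P) (B : ℕ) →
  ((α : Vecℕ n) → P α → (j : Fin n) → lookup α j ≤ B) →
  Σ (List (Vecℕ n)) (λ xs → (α : Vecℕ n) → (P α ⇔ α ∈ xs))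
bounded⇒listable {n} P? B bound = filter P? (box B n) , λ α → mk⇔
  (λ Pα → ∈-filter⁺ P? (∈-box B n α (bound α Pα)) Pα)
  (λ α∈ → proj₂ (∈-filter⁻ P? {xs = box B n} α∈))

lemma2p2 : (n : ℕ) (N : Vecℕ n) (I : Subset n) →
    Σ (List (Vecℕ n)) (λ xs → (α : Vecℕ n) → (α ∈𝒥[ I , N ] ⇔ α ∈ xs))
    × ((α : Vecℕ n) → α ∈𝒥[ I , N ] → (j : Fin n) → lookup α j ≤ total N + n)
lemma2p2 n N I = bounded⇒listable (_∈𝒥?[ I , N ]) (total N + n) coordinate-bound
               , coordinate-bound
  where
  coordinate-bound : (α : Vecℕ n) → α ∈𝒥[ I , N ] → (j : Fin n) → lookup α j ≤ total N + n
  coordinate-bound α α∈𝒥 j = ≤-trans (lookup≤total α j)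
    (≤-trans (∈𝒥⇒total≤ n N I α α∈𝒥) (≤-reflexive (+-comm n (total N))))
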